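{- Let $G$ be a finite group which is not a $p$-group (for any prime $p$). If the center $Z(G)$ is non-trivial, then the difference graph $D(G)$ is connected and $\operatorname{diam}(D(G))\leq 6$.
   Context: For a group $G$, the power graph $\mathsf{Pow}(G)$ has vertex set $G$, with distinct $a,b$ adjacent iff $a\in\langle b\rangle$ or $b\in\langle a\rangle$. The enhanced power graph $\mathsf{EPow}(G)$ has vertex set $G$, with distinct $a,b$ adjacent iff $\langle a,b\rangle$ is cyclic. The difference graph $D(G)$ is the graph $\mathsf{EPow}(G)-\mathsf{Pow}(G)$ with all isolated vertices removed; thus $x\sim y$ in $D(G)$ iff $\langle x,y\rangle$ is cyclic, $x\notin\langle y\rangle$ and $y\notin\langle x\rangle$. -}

module Defs where

open import Data.Nat using (ℕ; zero; suc; _^_; _≤_)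
open import Data.Nat.Primality using (Prime)
open import Data.Fin using (Fin)
open import Data.List using (List; []; _∷_)
open import Data.List.Membership.Propositional using (_∈_)
open import Data.Product using (Σ; ∃; _×_; _,_)
open import Relation.Nullary using (¬_)
open import Relation.Binary.PropositionalEquality using (_≡_; _≢_)
open import Function.Bundles using (_⇔_)

-- A finite group of order n, presented on the carrier Fin n
-- (every finite group is isomorphic to one of these).
record FinGroup (n : ℕ) : Set where
  infixl 7 _·_
  field
    _·_   : Fin n → Fin n → Fin n
    e     : Fin n
    inv   : Fin n → Fin n
    assoc : ∀ x y z → (x · y) · z ≡ x · (y · z)
    idˡ   : ∀ x → e · x ≡ x
    idʳ   : ∀ x → x · e ≡ x
    invˡ  : ∀ x → inv x · x ≡ e
    invʳ  : ∀ x → x · inv x ≡ e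

module _ {n : ℕ} (G : FinGroup n) where
  open FinGroup G

  -- g ∈ ⟨S⟩ : the subgroup generated by the list S, as the closure of e
  -- under left multiplication by generators and their inverses.
  data InGen (S : List (Fin n)) : Fin n → Set where
    gen-e   : InGen S e
    gen-mul : ∀ {s g} → s ∈ S → InGen S g → InGen S (s · g)
    gen-inv : ∀ {s g} → s ∈ S → InGen S g → InGen S (inv s · g)

  InCyc : Fin n → Fin n → Set
  InCyc a b = InGen (b ∷ []) a

  GenCyclic : Fin n → Fin n → Set
  GenCyclic x y = ∃ λ z → ∀ g → InGen (x ∷ y ∷ []) g ⇔ InCyc g z

  -- adjacency in the difference graph D(G) = EPow(G) - Pow(G)
  DAdj : Fin n → Fin n → Set
  DAdj x y = x ≢ y × GenCyclic x y × ¬ InCyc x y × ¬ InCyc y x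

  -- vertices of D(G): non-isolated vertices of EPow(G) - Pow(G)
  DVertex : Fin n → Set
  DVertex x = ∃ λ y → DAdj x y

  data DWalk : Fin n → Fin n → ℕ → Set where
    walk-nil  : ∀ {x} → DWalk x x zero
    walk-cons : ∀ {x y z k} → DAdj x y → DWalk y z k → DWalk x z (suc k)

  CenterNontrivial : Set
  CenterNontrivial = ∃ λ z → z ≢ e × (∀ g → z · g ≡ g · z)

  ConnectedDiamLe : ℕ → Set
  ConnectedDiamLe d =
    (∃ λ v → DVertex v) ×
    (∀ u v → DVertex u → DVertex v → ∃ λ k → k ≤ d × DWalk u v k)

-- a group of order n is a p-group iff n is a prime power
IsPGroupOrder : ℕ → Set
IsPGroupOrder n = ∃ λ p → Prime p × ∃ λ k → n ≡ p ^ k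

-- A nontrivial central element has a power z of prime order p. Every vertex x of D(G) lies in
-- a cyclic group ⟨c⟩ = ⟨x , y⟩ with x ∉ ⟨y⟩ and y ∉ ⟨x⟩; write the order of c as p^a r with p ∤ r.
-- A nontrivial element of order prime to p commutes with z and is adjacent to it, since the two
-- generate the cyclic group of their product. The p′-part c^(p^a) is nontrivial, because the
-- subgroups of a cyclic p-group form a chain; splitting x into its p- and p′-parts then gives a
-- path of length at most 3 from x to z, so any two vertices are at distance at most 6.
-- D(G) is nonempty: as |G| is not a power of p it has a prime divisor q ≠ p, and by Cauchy's
-- theorem (McKay's count of the rotation-invariant q-tuples with product 1) an element of order
-- q, which is adjacent to z.

module Submission where

open import Level using (0ℓ)
open import Algebra.Bundles using (Group)
import Algebra.Properties.Group as GroupProperties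
import Algebra.Properties.Monoid.Mult as MonoidMultProperties
open import Data.Nat as ℕ
  using (ℕ; zero; suc; _+_; _*_; _∸_; _%_; _/_; _<_; _≤_; _≟_; z≤n; s≤s; NonZero; ≢-nonZero; nonTrivial⇒n>1)
open import Data.Nat.Properties
  using ( +-comm; *-comm; *-assoc; *-identityˡ; +-suc; ≤-refl; ≤-trans; ≤-<-trans; <⇒≤; <⇒≢; +-mono-≤
        ; suc-injective; n<1+n; m<m*n; m<n+m; m∸n≤m; m∸n+n≡m; m<n⇒0<n∸m; m≤n⇒∃[o]m+o≡n)
open import Data.Nat.Induction using (<-wellFounded)
open import Data.Nat.DivMod using (m≡m%n+[m/n]*n; m%n<n)
open import Data.Nat.Divisibility
  using (_∣_; _∤_; divides; _∣?_; _∣0; ∣-refl; ∣-trans; ∣m∣n⇒∣m+n; ∣m+n∣m⇒∣n; m∣m*n; ∣⇒≤)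
open import Data.Nat.Coprimality
  using (Coprime; coprime-Bézout; coprime-divisor; 1-coprimeTo; prime⇒coprime)
  renaming (sym to coprime-sym)
open import Data.Nat.GCD using (module Bézout)
open import Data.Nat.Primality using (Prime; prime⇒irreducible; prime⇒nonTrivial; prime⇒nonZero)
open import Data.Nat.Primality.Factorisation using (factorise; PrimeFactorisation)
open import Data.Nat.ListAction using (product)
open import Data.Nat.ListAction.Properties using (∈⇒∣product)
open import Data.Fin using (Fin; toℕ; fromℕ<) renaming (_≟_ to _≟ᶠ_)
open import Data.Fin.Properties using (pigeonhole; toℕ-fromℕ<; any?; nonZeroIndex)
open import Data.List
  using ( List; []; _∷_; _++_; _∷ʳ_; length; map; replicate; filter; foldr; allFin; applyUpTo
        ; cartesianProductWith; initLast; _∷ʳ′_)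
open import Data.List.Properties
  using ( ≡-dec; ∷-injective; ∷ʳ-injectiveˡ; ++-assoc; ++-identityʳ
        ; length-++; length-map; length-tabulate; length-replicate; length-applyUpTo)
open import Data.List.Membership.Propositional using (_∈_; find)
open import Data.List.Membership.Propositional.Properties
  using ( ∈-map⁺; ∈-map⁻; ∈-filter⁺; ∈-filter⁻; ∈-allFin; ∈-length; ∈-applyUpTo⁺; ∈-applyUpTo⁻
        ; ∈-cartesianProductWith⁺; ∈-cartesianProductWith⁻)
open import Data.List.Membership.Propositional.Properties.WithK using (unique∧set⇒bag)
import Data.List.Membership.DecPropositional as DecMembership
open import Data.List.Relation.Binary.BagAndSetEquality using (∼bag⇒↭)
open import Data.List.Relation.Binary.Permutation.Propositional.Properties using (↭-length)
open import Data.List.Relation.Unary.Any using (here; there)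
open import Data.List.Relation.Unary.All using (All; []; _∷_; all?; lookup)
open import Data.List.Relation.Unary.All.Properties using (¬All⇒Any¬)
open import Data.List.Relation.Unary.AllPairs using ([]; _∷_)
open import Data.List.Relation.Unary.Unique.Propositional using (Unique)
open import Data.List.Relation.Unary.Unique.Propositional.Properties
  using (map⁺; filter⁺; allFin⁺; applyUpTo⁺₁; cartesianProductWith⁺)
open import Data.Product using (∃; ∃₂; _×_; _,_; proj₁; proj₂)
open import Data.Sum using (_⊎_; inj₁; inj₂)
open import Data.Empty using (⊥-elim)
open import Function.Base using (_∘_)
open import Function.Bundles using (mk⇔; Equivalence)
import Function.Endo.Propositional as Endo
open import Induction.WellFounded using (Acc; acc)
open import Relation.Nullary using (Dec; ¬_; yes; no)
open import Relation.Nullary.Decidable using (map′)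
open import Relation.Unary using (Pred; Decidable)
open import Relation.Unary.Properties using (∁?)
open import Relation.Binary.Definitions using (DecidableEquality)
open import Relation.Binary.PropositionalEquality

open import Defs

-- Prime factors

prime⇒1< : ∀ {p} → Prime p → 1 < p
prime⇒1< pp = nonTrivial⇒n>1 _ {{prime⇒nonTrivial pp}}

p-part : ∀ {p} → Prime p → ∀ M → M ≢ 0 → ∃₂ λ a r → M ≡ p ℕ.^ a * r × p ∤ r
p-part {p} pp M = go M (<-wellFounded M)
  where
  go : ∀ M → Acc _<_ M → M ≢ 0 → ∃₂ λ a r → M ≡ p ℕ.^ a * r × p ∤ r
  go M (acc rec) M≢0 with p ∣? M
  ... | no p∤M = 0 , M , sym (*-identityˡ M) , p∤M
  ... | yes (divides t M≡t*p) with go t (rec t<M) t≢0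
    where
    t≢0 : t ≢ 0
    t≢0 refl = M≢0 M≡t*p
    instance _ = ≢-nonZero t≢0
    t<M : t < M
    t<M = subst (t <_) (sym M≡t*p) (m<m*n t p (prime⇒1< pp))
  ... | a , r , t≡p^a*r , p∤r = suc a , r , M≡p^[1+a]*r , p∤r
    where
    open ≡-Reasoning
    M≡p^[1+a]*r : M ≡ p * p ℕ.^ a * r
    M≡p^[1+a]*r = begin
      M                  ≡⟨ M≡t*p ⟩
      t * p              ≡⟨ *-comm t p ⟩
      p * t              ≡⟨ cong (p *_) t≡p^a*r ⟩
      p * (p ℕ.^ a * r)  ≡⟨ sym (*-assoc p (p ℕ.^ a) r) ⟩
      p * p ℕ.^ a * r    ∎

∤⇒coprime : ∀ {p r} → Prime p → p ∤ r → Coprime p r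
∤⇒coprime pp p∤r (d∣p , d∣r) with prime⇒irreducible pp d∣p
... | inj₁ d≡1 = d≡1
... | inj₂ refl = ⊥-elim (p∤r d∣r)

∤⇒coprime-^ : ∀ {p r} → Prime p → p ∤ r → ∀ a → Coprime (p ℕ.^ a) r
∤⇒coprime-^ {p} {r} pp p∤r zero = 1-coprimeTo r
∤⇒coprime-^ {p} {r} pp p∤r (suc a) {d} (d∣p^[1+a] , d∣r) =
  ∤⇒coprime pp p∤r (coprime-divisor d⊥p^a (subst (d ∣_) (*-comm p (p ℕ.^ a)) d∣p^[1+a]) , d∣r)
  where
  d⊥p^a : Coprime d (p ℕ.^ a)
  d⊥p^a (x∣d , x∣p^a) = ∤⇒coprime-^ pp p∤r a (x∣p^a , ∣-trans x∣d d∣r)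

distinct-primes-∤ : ∀ {p q} → Prime p → Prime q → p ≢ q → p ∤ q
distinct-primes-∤ pp pq p≢q p∣q with prime⇒irreducible pq p∣q
... | inj₁ p≡1 = <⇒≢ (prime⇒1< pp) (sym p≡1)
... | inj₂ p≡q = p≢q p≡q

product-replicate : ∀ {p ps} → All (_≡ p) ps → product ps ≡ p ℕ.^ length ps
product-replicate [] = refl
product-replicate {p} (refl ∷ ps≡p) = cong (p *_) (product-replicate ps≡p)

¬prime-power⇒other-prime-divisor : ∀ {n p} .{{_ : NonZero n}} → ¬ IsPGroupOrder n → Prime p →
                                    ∃ λ q → Prime q × q ∣ n × q ≢ p
¬prime-power⇒other-prime-divisor {n} {p} ¬p-power pp = from (factorise n)
  where
  from : PrimeFactorisation n → ∃ λ q → Prime q × q ∣ n × q ≢ p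
  from record { factors = qs ; isFactorisation = n≡∏qs ; factorsPrime = qs-prime }
    with all? (_≟ p) qs
  ... | yes qs≡p = ⊥-elim (¬p-power (p , pp , length qs , trans n≡∏qs (product-replicate qs≡p)))
  ... | no ¬qs≡p with find (¬All⇒Any¬ (_≟ p) qs ¬qs≡p)
  ...   | q , q∈qs , q≢p = q , lookup qs-prime q∈qs , subst (q ∣_) (sym n≡∏qs) (∈⇒∣product q∈qs) , q≢p

-- Fixed points of a ℤ/q-action

length-filter-split : ∀ {A : Set} {ℓ} {P : Pred A ℓ} (P? : Decidable P) xs →
                      length xs ≡ length (filter P? xs) + length (filter (∁? P?) xs)
length-filter-split P? [] = refl
length-filter-split P? (x ∷ xs) with P? x
... | yes _ = cong suc (length-filter-split P? xs)
... | no _ = trans (cong suc (length-filter-split P? xs)) (sym (+-suc _ _))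

module _ {A : Set} (_≟_ : DecidableEquality A) where
  open DecMembership _≟_ using (_∈?_)

  length-⊆-split : ∀ {xs ys} → Unique xs → Unique ys → (∀ {a} → a ∈ xs → a ∈ ys) →
                   length ys ≡ length xs + length (filter (∁? (_∈? xs)) ys)
  length-⊆-split {xs} {ys} xs-unique ys-unique xs⊆ys =
    trans (length-filter-split (_∈? xs) ys) (cong (_+ length (filter (∁? (_∈? xs)) ys)) |ys∩xs|≡|xs|)
    where
    |ys∩xs|≡|xs| : length (filter (_∈? xs) ys) ≡ length xs
    |ys∩xs|≡|xs| = ↭-length (∼bag⇒↭ (unique∧set⇒bag (filter⁺ (_∈? xs) ys-unique) xs-unique
      (mk⇔ (proj₂ ∘ ∈-filter⁻ (_∈? xs) {xs = ys}) (λ a∈xs → ∈-filter⁺ (_∈? xs) (xs⊆ys a∈xs) a∈xs))))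

module Iteration {A : Set} (σ : A → A) where
  open Endo A using (_^_; ^-homo) public

  Fixed : A → Set
  Fixed a = σ a ≡ a

  ^-+ : ∀ i j a → (σ ^ (i + j)) a ≡ (σ ^ i) ((σ ^ j) a)
  ^-+ i j a = cong (λ f → f a) (^-homo σ i j)

  ^-comm : ∀ i j a → (σ ^ i) ((σ ^ j) a) ≡ (σ ^ j) ((σ ^ i) a)
  ^-comm i j a = trans (sym (^-+ i j a)) (trans (cong (λ k → (σ ^ k) a) (+-comm i j)) (^-+ j i a))

  fixed-^ : ∀ {a} → Fixed a → ∀ k → (σ ^ k) a ≡ a
  fixed-^ σa≡a zero = refl
  fixed-^ σa≡a (suc k) = trans (cong σ (fixed-^ σa≡a k)) σa≡a

  period-^-* : ∀ {a} d → (σ ^ d) a ≡ a → ∀ m → (σ ^ (m * d)) a ≡ a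
  period-^-* d σ^d[a]≡a zero = refl
  period-^-* {a} d σ^d[a]≡a (suc m) =
    trans (^-+ d (m * d) a) (trans (cong (σ ^ d) (period-^-* d σ^d[a]≡a m)) σ^d[a]≡a)

module OrbitCounting {A : Set} (_≟_ : DecidableEquality A) (σ : A → A) {q : ℕ} (q-prime : Prime q) where
  open Iteration σ public
  open DecMembership _≟_ using (_∈?_)

  private instance
    q-nonZero : NonZero q
    q-nonZero = prime⇒nonZero q-prime

  Fixed? : Decidable Fixed
  Fixed? a = σ a ≟ a

  Periodic : A → Set
  Periodic a = (σ ^ q) a ≡ a

  Closed : List A → Set
  Closed xs = ∀ {a} → a ∈ xs → σ a ∈ xs

  periodic-^ : ∀ {a} → Periodic a → ∀ k → Periodic ((σ ^ k) a)
  periodic-^ {a} σ^q[a]≡a k = trans (^-comm q k a) (cong (σ ^ k) σ^q[a]≡a)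

  periodic-^-mod : ∀ {a} → Periodic a → ∀ k → (σ ^ k) a ≡ (σ ^ (k % q)) a
  periodic-^-mod {a} σ^q[a]≡a k = begin
    (σ ^ k) a                                    ≡⟨ cong (λ m → (σ ^ m) a) (m≡m%n+[m/n]*n k q) ⟩
    (σ ^ (k % q + k / q * q)) a                  ≡⟨ ^-+ (k % q) (k / q * q) a ⟩
    (σ ^ (k % q)) ((σ ^ (k / q * q)) a)          ≡⟨ cong (σ ^ (k % q)) (period-^-* q σ^q[a]≡a (k / q)) ⟩
    (σ ^ (k % q)) a                              ∎
    where
    open ≡-Reasoning

  periods-coprime⇒fixed : ∀ {a d} → Coprime d q → (σ ^ d) a ≡ a → Periodic a → Fixed a
  periods-coprime⇒fixed {a} {d} d⊥q σ^d[a]≡a σ^q[a]≡a with coprime-Bézout d⊥q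
  ... | Bézout.+- x y 1+yq≡xd = begin
    σ a                    ≡⟨ cong σ (sym (period-^-* q σ^q[a]≡a y)) ⟩
    (σ ^ (1 + y * q)) a    ≡⟨ cong (λ k → (σ ^ k) a) 1+yq≡xd ⟩
    (σ ^ (x * d)) a        ≡⟨ period-^-* d σ^d[a]≡a x ⟩
    a                      ∎
    where open ≡-Reasoning
  ... | Bézout.-+ x y 1+xd≡yq = begin
    σ a                    ≡⟨ cong σ (sym (period-^-* d σ^d[a]≡a x)) ⟩
    (σ ^ (1 + x * d)) a    ≡⟨ cong (λ k → (σ ^ k) a) 1+xd≡yq ⟩
    (σ ^ (y * q)) a        ≡⟨ period-^-* q σ^q[a]≡a y ⟩
    a                      ∎
    where open ≡-Reasoning

  periodic⇒σ-invertible : ∀ {a} → Periodic a → a ≡ (σ ^ (q ∸ 1)) (σ a)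
  periodic⇒σ-invertible {a} σ^q[a]≡a = begin
    a                       ≡⟨ sym σ^q[a]≡a ⟩
    (σ ^ q) a               ≡⟨ cong (λ k → (σ ^ k) a) (sym (m∸n+n≡m (ℕ.>-nonZero⁻¹ q))) ⟩
    (σ ^ (q ∸ 1 + 1)) a     ≡⟨ ^-+ (q ∸ 1) 1 a ⟩
    (σ ^ (q ∸ 1)) (σ a)     ∎
    where open ≡-Reasoning

  fixed-σ⇒fixed : ∀ {a} → Periodic a → Fixed (σ a) → Fixed a
  fixed-σ⇒fixed σ^q[a]≡a σa-fixed = sym (trans (periodic⇒σ-invertible σ^q[a]≡a) (fixed-^ σa-fixed (q ∸ 1)))

  fixed-^⇒fixed : ∀ {a} → Periodic a → ∀ k → Fixed ((σ ^ k) a) → Fixed a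
  fixed-^⇒fixed σ^q[a]≡a zero a-fixed = a-fixed
  fixed-^⇒fixed σ^q[a]≡a (suc k) σ^[1+k]a-fixed =
    fixed-^⇒fixed σ^q[a]≡a k (fixed-σ⇒fixed (periodic-^ σ^q[a]≡a k) σ^[1+k]a-fixed)

  ^-closed : ∀ {xs a} → Closed xs → a ∈ xs → ∀ k → (σ ^ k) a ∈ xs
  ^-closed closed a∈xs zero = a∈xs
  ^-closed closed a∈xs (suc k) = closed (^-closed closed a∈xs k)

  orbit : A → List A
  orbit y = applyUpTo (λ i → (σ ^ i) y) q

  ^-∈-orbit : ∀ {y} → Periodic y → ∀ k → (σ ^ k) y ∈ orbit y
  ^-∈-orbit {y} σ^q[y]≡y k =
    subst (_∈ orbit y) (sym (periodic-^-mod σ^q[y]≡y k)) (∈-applyUpTo⁺ (λ i → (σ ^ i) y) (m%n<n k q))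

  orbit-⊆ : ∀ {xs y a} → Closed xs → y ∈ xs → a ∈ orbit y → a ∈ xs
  orbit-⊆ {y = y} closed y∈xs a∈orbit with ∈-applyUpTo⁻ (λ i → (σ ^ i) y) a∈orbit
  ... | i , _ , refl = ^-closed closed y∈xs i

  σ⁻¹-orbit : ∀ {y a} → Periodic y → Periodic a → σ a ∈ orbit y → a ∈ orbit y
  σ⁻¹-orbit {y} {a} σ^q[y]≡y σ^q[a]≡a σa∈orbit with ∈-applyUpTo⁻ (λ i → (σ ^ i) y) σa∈orbit
  ... | i , _ , σa≡σ^i[y] = subst (_∈ orbit y) (sym a≡) (^-∈-orbit σ^q[y]≡y (q ∸ 1 + i))
    where
    a≡ : a ≡ (σ ^ (q ∸ 1 + i)) y
    a≡ = trans (periodic⇒σ-invertible σ^q[a]≡a)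
           (trans (cong (σ ^ (q ∸ 1)) σa≡σ^i[y]) (sym (^-+ (q ∸ 1) i y)))

  orbit-unique : ∀ {y} → Periodic y → ¬ Fixed y → Unique (orbit y)
  orbit-unique {y} σ^q[y]≡y y-not-fixed = applyUpTo⁺₁ (λ i → (σ ^ i) y) q distinct
    where
    distinct : ∀ {i j} → i < j → j < q → (σ ^ i) y ≢ (σ ^ j) y
    distinct {i} {j} i<j j<q σ^i[y]≡σ^j[y] =
      y-not-fixed (fixed-^⇒fixed σ^q[y]≡y i (periods-coprime⇒fixed j-i⊥q σ^[j-i]w≡w (periodic-^ σ^q[y]≡y i)))
      where
      j-i⊥q : Coprime (j ∸ i) q
      j-i⊥q = coprime-sym (prime⇒coprime q-prime {{ℕ.>-nonZero (m<n⇒0<n∸m i<j)}} (≤-<-trans (m∸n≤m j i) j<q))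
      σ^[j-i]w≡w : (σ ^ (j ∸ i)) ((σ ^ i) y) ≡ (σ ^ i) y
      σ^[j-i]w≡w = trans (sym (^-+ (j ∸ i) i y))
                     (trans (cong (λ k → (σ ^ k) y) (m∸n+n≡m (<⇒≤ i<j))) (sym σ^i[y]≡σ^j[y]))

  non-fixed-divisible : ∀ {xs} → Unique xs → Closed xs →
                        (∀ {a} → a ∈ xs → Periodic a × ¬ Fixed a) → q ∣ length xs
  non-fixed-divisible {xs} = go xs (<-wellFounded (length xs))
    where
    go : ∀ xs → Acc _<_ (length xs) → Unique xs → Closed xs →
         (∀ {a} → a ∈ xs → Periodic a × ¬ Fixed a) → q ∣ length xs
    go [] _ _ _ _ = q ∣0
    go xs@(y ∷ _) (acc rec) xs-unique closed free =
      subst (q ∣_) (sym |xs|≡q+|ys|)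
        (∣m∣n⇒∣m+n ∣-refl (go ys (rec |ys|<|xs|) (filter⁺ outside? xs-unique) ys-closed (free ∘ ys⊆xs)))
      where
      y-periodic = proj₁ (free (here refl))
      outside? = ∁? (_∈? orbit y)
      ys = filter outside? xs
      ys⊆xs : ∀ {a} → a ∈ ys → a ∈ xs
      ys⊆xs = proj₁ ∘ ∈-filter⁻ outside?
      |xs|≡q+|ys| : length xs ≡ q + length ys
      |xs|≡q+|ys| =
        trans (length-⊆-split _≟_ (orbit-unique y-periodic (proj₂ (free (here refl)))) xs-unique
                (orbit-⊆ closed (here refl)))
              (cong (_+ length ys) (length-applyUpTo (λ i → (σ ^ i) y) q))
      |ys|<|xs| : length ys < length xs
      |ys|<|xs| = subst (length ys <_) (sym |xs|≡q+|ys|) (m<n+m (length ys) (ℕ.>-nonZero⁻¹ q))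
      ys-closed : Closed ys
      ys-closed a∈ys with ∈-filter⁻ outside? a∈ys
      ... | a∈xs , a∉orbit =
        ∈-filter⁺ outside? (closed a∈xs) (a∉orbit ∘ σ⁻¹-orbit y-periodic (proj₁ (free a∈xs)))

  fixed-points-divisible : ∀ {xs} → Unique xs → Closed xs → (∀ {a} → a ∈ xs → Periodic a) →
                           q ∣ length xs → q ∣ length (filter Fixed? xs)
  fixed-points-divisible {xs} xs-unique closed periodic q∣|xs| =
    ∣m+n∣m⇒∣n (subst (q ∣_) (trans (length-filter-split Fixed? xs) (+-comm (length (filter Fixed? xs)) _))
                      q∣|xs|)
      (non-fixed-divisible (filter⁺ (∁? Fixed?) xs-unique) non-fixed-closed non-fixed-free)
    where
    non-fixed-closed : Closed (filter (∁? Fixed?) xs)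
    non-fixed-closed a∈nf with ∈-filter⁻ (∁? Fixed?) a∈nf
    ... | a∈xs , a-not-fixed =
      ∈-filter⁺ (∁? Fixed?) (closed a∈xs) (a-not-fixed ∘ fixed-σ⇒fixed (periodic a∈xs))
    non-fixed-free : ∀ {a} → a ∈ filter (∁? Fixed?) xs → Periodic a × ¬ Fixed a
    non-fixed-free a∈nf with ∈-filter⁻ (∁? Fixed?) a∈nf
    ... | a∈xs , a-not-fixed = periodic a∈xs , a-not-fixed

-- Powers and cyclic subgroups

module Powers {n : ℕ} (G : FinGroup n) where
  open FinGroup G

  group : Group 0ℓ 0ℓ
  group = record
    { _≈_ = _≡_ ; _∙_ = _·_ ; ε = e ; _⁻¹ = inv
    ; isGroup = record
      { isMonoid = record
        { isSemigroup = record
          { isMagma = record { isEquivalence = isEquivalence ; ∙-cong = cong₂ _·_ }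
          ; assoc = assoc }
        ; identity = idˡ , idʳ }
      ; inverse = invˡ , invʳ
      ; ⁻¹-cong = cong inv } }

  open GroupProperties group public
    using (inverseʳ-unique; ε⁻¹≈ε; ⁻¹-involutive; ⁻¹-anti-homo-∙; identityˡ-unique; x≈z//y)
  open MonoidMultProperties (Group.monoid group) using (×-homo-+; ×-assocˡ) renaming (_×_ to _×ᵐ_)

  infixr 8 _^_
  _^_ : Fin n → ℕ → Fin n
  g ^ k = k ×ᵐ g

  ^-+ : ∀ g i j → g ^ (i + j) ≡ g ^ i · g ^ j
  ^-+ = ×-homo-+

  ^-*-assoc : ∀ g i j → (g ^ i) ^ j ≡ g ^ (i * j)
  ^-*-assoc g i j = trans (×-assocˡ g j i) (cong (g ^_) (*-comm j i))

  ^-comm : ∀ g i j → (g ^ i) ^ j ≡ (g ^ j) ^ i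
  ^-comm g i j = trans (^-*-assoc g i j) (trans (cong (g ^_) (*-comm i j)) (sym (^-*-assoc g j i)))

  ε^ : ∀ k → e ^ k ≡ e
  ε^ zero = refl
  ε^ (suc k) = trans (idˡ _) (ε^ k)

  ^-annihilates-powers : ∀ g N k → g ^ N ≡ e → (g ^ k) ^ N ≡ e
  ^-annihilates-powers g N k g^N≡e = trans (^-comm g k N) (trans (cong (_^ k) g^N≡e) (ε^ k))

  ^-·-comm : ∀ g i j → g ^ i · g ^ j ≡ g ^ j · g ^ i
  ^-·-comm g i j = trans (sym (^-+ g i j)) (trans (cong (g ^_) (+-comm i j)) (^-+ g j i))

  comm-^ : ∀ {g h} → g · h ≡ h · g → ∀ k → g · h ^ k ≡ h ^ k · g
  comm-^ {g} gh≡hg zero = trans (idʳ g) (sym (idˡ g))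
  comm-^ {g} {h} gh≡hg (suc k) = begin
    g · (h · h ^ k)   ≡⟨ sym (assoc _ _ _) ⟩
    (g · h) · h ^ k   ≡⟨ cong (_· h ^ k) gh≡hg ⟩
    (h · g) · h ^ k   ≡⟨ assoc _ _ _ ⟩
    h · (g · h ^ k)   ≡⟨ cong (h ·_) (comm-^ gh≡hg k) ⟩
    h · (h ^ k · g)   ≡⟨ sym (assoc _ _ _) ⟩
    (h · h ^ k) · g   ∎
    where open ≡-Reasoning

  ^-distrib-· : ∀ {g h} → g · h ≡ h · g → ∀ k → (g · h) ^ k ≡ g ^ k · h ^ k
  ^-distrib-· gh≡hg zero = sym (idˡ e)
  ^-distrib-· {g} {h} gh≡hg (suc k) = begin
    (g · h) · (g · h) ^ k       ≡⟨ cong ((g · h) ·_) (^-distrib-· gh≡hg k) ⟩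
    (g · h) · (g ^ k · h ^ k)   ≡⟨ assoc _ _ _ ⟩
    g · (h · (g ^ k · h ^ k))   ≡⟨ cong (g ·_) (sym (assoc _ _ _)) ⟩
    g · ((h · g ^ k) · h ^ k)   ≡⟨ cong (λ t → g · (t · h ^ k)) (comm-^ (sym gh≡hg) k) ⟩
    g · ((g ^ k · h) · h ^ k)   ≡⟨ cong (g ·_) (assoc _ _ _) ⟩
    g · (g ^ k · (h · h ^ k))   ≡⟨ sym (assoc _ _ _) ⟩
    (g · g ^ k) · (h · h ^ k)   ∎
    where open ≡-Reasoning

module Subgroups {n : ℕ} (G : FinGroup n) where
  open FinGroup G
  open Powers G

  gen-∈ : ∀ {S s} → s ∈ S → InGen G S s
  gen-∈ {S} {s} s∈S = subst (InGen G S) (idʳ s) (gen-mul s∈S gen-e)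

  gen-· : ∀ {S a b} → InGen G S a → InGen G S b → InGen G S (a · b)
  gen-· {S} {b = b} gen-e gb = subst (InGen G S) (sym (idˡ b)) gb
  gen-· {S} {b = b} (gen-mul {s} {g} s∈S ga) gb =
    subst (InGen G S) (sym (assoc s g b)) (gen-mul s∈S (gen-· ga gb))
  gen-· {S} {b = b} (gen-inv {s} {g} s∈S ga) gb =
    subst (InGen G S) (sym (assoc (inv s) g b)) (gen-inv s∈S (gen-· ga gb))

  gen-inverse : ∀ {S a} → InGen G S a → InGen G S (inv a)
  gen-inverse {S} gen-e = subst (InGen G S) (sym ε⁻¹≈ε) gen-e
  gen-inverse {S} (gen-mul {s} {g} s∈S ga) =
    subst (InGen G S) (sym (⁻¹-anti-homo-∙ s g))
      (gen-· (gen-inverse ga) (subst (InGen G S) (idʳ (inv s)) (gen-inv s∈S gen-e)))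
  gen-inverse {S} (gen-inv {s} {g} s∈S ga) =
    subst (InGen G S) (sym (trans (⁻¹-anti-homo-∙ (inv s) g) (cong (inv g ·_) (⁻¹-involutive s))))
      (gen-· (gen-inverse ga) (gen-∈ s∈S))

  gen-^ : ∀ {S a} → InGen G S a → ∀ k → InGen G S (a ^ k)
  gen-^ ga zero = gen-e
  gen-^ ga (suc k) = gen-· ga (gen-^ ga k)

  gen-least : ∀ {S T g} → (∀ {s} → s ∈ S → InGen G T s) → InGen G S g → InGen G T g
  gen-least S⊆T gen-e = gen-e
  gen-least S⊆T (gen-mul s∈S ga) = gen-· (S⊆T s∈S) (gen-least S⊆T ga)
  gen-least S⊆T (gen-inv s∈S ga) = gen-· (gen-inverse (S⊆T s∈S)) (gen-least S⊆T ga)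

  gen-ε : ∀ {S g} → g ≡ e → InGen G S g
  gen-ε refl = gen-e

  gen-[] : ∀ {g} → InGen G [] g → g ≡ e
  gen-[] gen-e = refl

  cyc-refl : ∀ a → InCyc G a a
  cyc-refl a = gen-∈ (here refl)

  cyc-^ : ∀ a k → InCyc G (a ^ k) a
  cyc-^ a = gen-^ (cyc-refl a)

  cyc-trans : ∀ {a b c} → InCyc G a b → InCyc G b c → InCyc G a c
  cyc-trans a∈⟨b⟩ b∈⟨c⟩ = gen-least (λ { (here refl) → b∈⟨c⟩ }) a∈⟨b⟩

  cyc-≡ : ∀ {a b c} → a ≡ b → InCyc G b c → InCyc G a c
  cyc-≡ refl b∈⟨c⟩ = b∈⟨c⟩

  finite-order : ∀ g → ∃ λ N → g ^ suc N ≡ e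
  finite-order g with pigeonhole (n<1+n n) (λ (i : Fin (suc n)) → g ^ toℕ i)
  ... | i , j , i<j , g^i≡g^j with m≤n⇒∃[o]m+o≡n i<j
  ... | N , i+1+N≡j = N , identityˡ-unique (g ^ suc N) (g ^ toℕ i) (begin
      g ^ suc N · g ^ toℕ i   ≡⟨ sym (^-+ g (suc N) (toℕ i)) ⟩
      g ^ (suc N + toℕ i)     ≡⟨ cong (g ^_) (trans (cong suc (+-comm N (toℕ i))) i+1+N≡j) ⟩
      g ^ toℕ j               ≡⟨ sym g^i≡g^j ⟩
      g ^ toℕ i               ∎)
    where open ≡-Reasoning

  cyc⇒power : ∀ {a b} → InCyc G a b → ∃ λ k → a ≡ b ^ k
  cyc⇒power gen-e = 0 , refl
  cyc⇒power (gen-mul (here refl) ga) with cyc⇒power ga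
  ... | k , a≡b^k = suc k , cong (_ ·_) a≡b^k
  cyc⇒power {b = b} (gen-inv (here refl) ga) with cyc⇒power ga | finite-order b
  ... | k , a≡b^k | N , b^[1+N]≡e =
    N + k , trans (cong₂ _·_ (sym (inverseʳ-unique b (b ^ N) b^[1+N]≡e)) a≡b^k) (sym (^-+ b N k))

  power⇒cyc : ∀ {a b} k → a ≡ b ^ k → InCyc G a b
  power⇒cyc {b = b} k a≡b^k = cyc-≡ a≡b^k (cyc-^ b k)

  ^-mod : ∀ g {N} → g ^ suc N ≡ e → ∀ k → g ^ k ≡ g ^ (k % suc N)
  ^-mod g {N} g^[1+N]≡e k = begin
    g ^ k                                      ≡⟨ cong (g ^_) (m≡m%n+[m/n]*n k (suc N)) ⟩
    g ^ (k % suc N + k / suc N * suc N)        ≡⟨ ^-+ g (k % suc N) _ ⟩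
    g ^ (k % suc N) · g ^ (k / suc N * suc N)  ≡⟨ cong (g ^ (k % suc N) ·_) g^[m*[1+N]]≡e ⟩
    g ^ (k % suc N) · e                        ≡⟨ idʳ _ ⟩
    g ^ (k % suc N)                            ∎
    where
    open ≡-Reasoning
    g^[m*[1+N]]≡e : g ^ (k / suc N * suc N) ≡ e
    g^[m*[1+N]]≡e = trans (sym (^-*-assoc g (k / suc N) (suc N)))
                      (^-annihilates-powers g (suc N) (k / suc N) g^[1+N]≡e)

  cyc? : ∀ a b → Dec (InCyc G a b)
  cyc? a b with finite-order b
  ... | N , b^[1+N]≡e = map′ bounded⇒cyc cyc⇒bounded (any? (λ (i : Fin (suc N)) → a ≟ᶠ b ^ toℕ i))
    where
    bounded⇒cyc : (∃ λ (i : Fin (suc N)) → a ≡ b ^ toℕ i) → InCyc G a b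
    bounded⇒cyc (i , a≡b^i) = power⇒cyc (toℕ i) a≡b^i
    cyc⇒bounded : InCyc G a b → ∃ λ (i : Fin (suc N)) → a ≡ b ^ toℕ i
    cyc⇒bounded a∈⟨b⟩ with cyc⇒power a∈⟨b⟩
    ... | k , a≡b^k = fromℕ< (m%n<n k (suc N)) ,
      trans a≡b^k (trans (^-mod b b^[1+N]≡e k) (cong (b ^_) (sym (toℕ-fromℕ< (m%n<n k (suc N))))))

module CoprimeOrders {n : ℕ} (G : FinGroup n) where
  open FinGroup G
  open Powers G
  open Subgroups G

  gen-bezout : ∀ {S g} x A y B → 1 + y * B ≡ x * A →
               InGen G S (g ^ A) → InGen G S (g ^ B) → InGen G S g
  gen-bezout {S} {g} x A y B eq g^A∈S g^B∈S =
    subst (InGen G S) (sym g≡) (gen-· (gen-^ g^A∈S x) (gen-inverse (gen-^ g^B∈S y)))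
    where
    open ≡-Reasoning
    g≡ : g ≡ (g ^ A) ^ x · inv ((g ^ B) ^ y)
    g≡ = x≈z//y g _ _ (begin
      g · (g ^ B) ^ y   ≡⟨ cong (g ·_) (^-*-assoc g B y) ⟩
      g ^ suc (B * y)   ≡⟨ cong (λ m → g ^ suc m) (*-comm B y) ⟩
      g ^ (1 + y * B)   ≡⟨ cong (g ^_) eq ⟩
      g ^ (x * A)       ≡⟨ cong (g ^_) (*-comm x A) ⟩
      g ^ (A * x)       ≡⟨ sym (^-*-assoc g A x) ⟩
      (g ^ A) ^ x       ∎)

  gen-coprime : ∀ {S g A B} → Coprime A B →
                InGen G S (g ^ A) → InGen G S (g ^ B) → InGen G S g
  gen-coprime cop g^A∈S g^B∈S with coprime-Bézout cop
  ... | Bézout.+- x y eq = gen-bezout x _ y _ eq g^A∈S g^B∈S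
  ... | Bézout.-+ x y eq = gen-bezout y _ x _ eq g^B∈S g^A∈S

  coprime-orders⇒≡ε : ∀ {g A B} → Coprime A B → g ^ A ≡ e → g ^ B ≡ e → g ≡ e
  coprime-orders⇒≡ε cop g^A≡e g^B≡e = gen-[] (gen-coprime cop (gen-ε g^A≡e) (gen-ε g^B≡e))

  cyc-^≡ε : ∀ {g h} N → InCyc G g h → h ^ N ≡ e → g ^ N ≡ e
  cyc-^≡ε {h = h} N g∈⟨h⟩ h^N≡e with cyc⇒power g∈⟨h⟩
  ... | k , refl = ^-annihilates-powers h N k h^N≡e

  cyc-commute : ∀ {a b c} → InCyc G a c → InCyc G b c → a · b ≡ b · a
  cyc-commute {c = c} a∈⟨c⟩ b∈⟨c⟩ with cyc⇒power a∈⟨c⟩ | cyc⇒power b∈⟨c⟩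
  ... | i , refl | j , refl = ^-·-comm c i j

  coprime-orders⇒∉cyc : ∀ {g h A B} → Coprime A B → g ^ A ≡ e → h ^ B ≡ e → g ≢ e → ¬ InCyc G g h
  coprime-orders⇒∉cyc {B = B} cop g^A≡e h^B≡e g≢e g∈⟨h⟩ =
    g≢e (coprime-orders⇒≡ε cop g^A≡e (cyc-^≡ε B g∈⟨h⟩ h^B≡e))

  module _ {g h A B} (gh≡hg : g · h ≡ h · g) (cop : Coprime A B)
           (g^A≡e : g ^ A ≡ e) (h^B≡e : h ^ B ≡ e) where

    cyc-·ˡ : InCyc G g (g · h)
    cyc-·ˡ = gen-coprime cop (gen-ε g^A≡e) (cyc-≡ (sym [gh]^B≡g^B) (cyc-^ (g · h) B))
      where
      [gh]^B≡g^B : (g · h) ^ B ≡ g ^ B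
      [gh]^B≡g^B = trans (^-distrib-· gh≡hg B) (trans (cong (g ^ B ·_) h^B≡e) (idʳ _))

    cyc-·ʳ : InCyc G h (g · h)
    cyc-·ʳ = gen-coprime cop (cyc-≡ (sym [gh]^A≡h^A) (cyc-^ (g · h) A)) (gen-ε h^B≡e)
      where
      [gh]^A≡h^A : (g · h) ^ A ≡ h ^ A
      [gh]^A≡h^A = trans (^-distrib-· gh≡hg A) (trans (cong (_· h ^ A) g^A≡e) (idˡ _))

  genCyclic-intro : ∀ {x y w} → InCyc G x w → InCyc G y w → InGen G (x ∷ y ∷ []) w → GenCyclic G x y
  genCyclic-intro x∈⟨w⟩ y∈⟨w⟩ w∈⟨x,y⟩ = _ , λ g → mk⇔
    (gen-least λ { (here refl) → x∈⟨w⟩ ; (there (here refl)) → y∈⟨w⟩ })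
    (gen-least λ { (here refl) → w∈⟨x,y⟩ })

  genCyclic-sym : ∀ {x y} → GenCyclic G x y → GenCyclic G y x
  genCyclic-sym (w , ⟨x,y⟩≡⟨w⟩) = w , λ g → mk⇔
    (λ g∈⟨y,x⟩ → Equivalence.to (⟨x,y⟩≡⟨w⟩ g) (gen-least swap g∈⟨y,x⟩))
    (λ g∈⟨w⟩ → gen-least swap (Equivalence.from (⟨x,y⟩≡⟨w⟩ g) g∈⟨w⟩))
    where
    swap : ∀ {a b s} → s ∈ a ∷ b ∷ [] → InGen G (b ∷ a ∷ []) s
    swap (here refl) = gen-∈ (there (here refl))
    swap (there (here refl)) = gen-∈ (here refl)

  DAdj-sym : ∀ {x y} → DAdj G x y → DAdj G y x
  DAdj-sym (x≢y , ⟨x,y⟩-cyclic , x∉⟨y⟩ , y∉⟨x⟩) = x≢y ∘ sym , genCyclic-sym ⟨x,y⟩-cyclic , y∉⟨x⟩ , x∉⟨y⟩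

  ∉cyc⇒≢ : ∀ {x y} → ¬ InCyc G y x → x ≢ y
  ∉cyc⇒≢ {x} y∉⟨x⟩ refl = y∉⟨x⟩ (cyc-refl x)

  DAdj-coprime-orders : ∀ {g h A B} → g · h ≡ h · g → Coprime A B → g ^ A ≡ e → h ^ B ≡ e →
                        g ≢ e → h ≢ e → DAdj G g h
  DAdj-coprime-orders gh≡hg cop g^A≡e h^B≡e g≢e h≢e =
    ∉cyc⇒≢ h∉⟨g⟩ ,
    genCyclic-intro (cyc-·ˡ gh≡hg cop g^A≡e h^B≡e) (cyc-·ʳ gh≡hg cop g^A≡e h^B≡e)
      (gen-· (gen-∈ (here refl)) (gen-∈ (there (here refl)))) ,
    coprime-orders⇒∉cyc cop g^A≡e h^B≡e g≢e ,
    h∉⟨g⟩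
    where h∉⟨g⟩ = coprime-orders⇒∉cyc (coprime-sym cop) h^B≡e g^A≡e h≢e

module CyclicSubgroups {n : ℕ} (G : FinGroup n) where
  open FinGroup G
  open Powers G
  open Subgroups G
  open CoprimeOrders G

  -- The group ⟨c^i , c^A⟩ is cyclic, generated by (c^i)^B · c^A.
  DAdj-coprime-part : ∀ {c A B} i → Coprime A B → c ^ (A * B) ≡ e →
                      (c ^ i) ^ B ≢ e → ¬ InCyc G (c ^ A) (c ^ i) → DAdj G (c ^ i) (c ^ A)
  DAdj-coprime-part {c} {A} {B} i A⊥B c^AB≡e x^B≢e u∉⟨x⟩ =
    ∉cyc⇒≢ u∉⟨x⟩ , genCyclic-intro x∈⟨w⟩ u∈⟨w⟩ w∈⟨x,u⟩ , x∉⟨u⟩ , u∉⟨x⟩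
    where
    x = c ^ i
    u = c ^ A
    w = x ^ B · u
    u^B≡e : u ^ B ≡ e
    u^B≡e = trans (^-*-assoc c A B) c^AB≡e
    x^B^A≡e : (x ^ B) ^ A ≡ e
    x^B^A≡e = trans (^-*-assoc x B A)
                (^-annihilates-powers c (B * A) i (trans (cong (c ^_) (*-comm B A)) c^AB≡e))
    x^B·u≡u·x^B : x ^ B · u ≡ u · x ^ B
    x^B·u≡u·x^B = cyc-commute (cyc-trans (cyc-^ x B) (cyc-^ c i)) (cyc-^ c A)
    x^B∈⟨w⟩ = cyc-·ˡ x^B·u≡u·x^B A⊥B x^B^A≡e u^B≡e
    u∈⟨w⟩ = cyc-·ʳ x^B·u≡u·x^B A⊥B x^B^A≡e u^B≡e
    x∈⟨w⟩ : InCyc G x w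
    x∈⟨w⟩ = gen-coprime (coprime-sym A⊥B) x^B∈⟨w⟩ (cyc-≡ (^-comm c i A) (cyc-trans (cyc-^ u i) u∈⟨w⟩))
    w∈⟨x,u⟩ : InGen G (x ∷ u ∷ []) w
    w∈⟨x,u⟩ = gen-· (gen-^ (gen-∈ (here refl)) B) (gen-∈ (there (here refl)))
    x∉⟨u⟩ : ¬ InCyc G x u
    x∉⟨u⟩ x∈⟨u⟩ = x^B≢e (cyc-^≡ε B x∈⟨u⟩ u^B≡e)

  coprime-power-generates : ∀ {p} → Prime p → ∀ a {c k} → c ^ (p ℕ.^ a) ≡ e → p ∤ k → InCyc G c (c ^ k)
  coprime-power-generates pp a c^p^a≡e p∤k =
    gen-coprime (coprime-sym (∤⇒coprime-^ pp p∤k a)) (cyc-refl _) (gen-ε c^p^a≡e)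

  cyclic-p-group-chain : ∀ {p} → Prime p → ∀ a {c} i j → c ^ (p ℕ.^ a) ≡ e →
                         InCyc G (c ^ i) (c ^ j) ⊎ InCyc G (c ^ j) (c ^ i)
  cyclic-p-group-chain pp zero {c} i j c^1≡e =
    inj₁ (gen-ε (trans (cong (_^ i) (trans (sym (idʳ c)) c^1≡e)) (ε^ i)))
  cyclic-p-group-chain {p} pp (suc a) {c} i j c^p^[1+a]≡e with p ∣? i | p ∣? j
  ... | no p∤i | _ = inj₂ (cyc-trans (cyc-^ c j) (coprime-power-generates pp (suc a) c^p^[1+a]≡e p∤i))
  ... | yes _ | no p∤j = inj₁ (cyc-trans (cyc-^ c i) (coprime-power-generates pp (suc a) c^p^[1+a]≡e p∤j))
  ... | yes (divides i′ refl) | yes (divides j′ refl) =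
    subst₂ (λ u v → InCyc G u v ⊎ InCyc G v u) (c^p^k≡c^[k*p] i′) (c^p^k≡c^[k*p] j′)
      (cyclic-p-group-chain pp a i′ j′ (trans (^-*-assoc c p (p ℕ.^ a)) c^p^[1+a]≡e))
    where
    c^p^k≡c^[k*p] : ∀ k → (c ^ p) ^ k ≡ c ^ (k * p)
    c^p^k≡c^[k*p] k = trans (^-*-assoc c p k) (cong (c ^_) (*-comm p k))

  prime-order-power : ∀ g qs → All Prime qs → g ^ product qs ≡ e → g ≢ e →
                      ∃₂ λ p k → Prime p × g ^ k ≢ e × (g ^ k) ^ p ≡ e
  prime-order-power g [] [] g^1≡e g≢e = ⊥-elim (g≢e (trans (sym (idʳ g)) g^1≡e))
  prime-order-power g (q ∷ qs) (q-prime ∷ qs-prime) g^[q*Q]≡e g≢e with g ^ q ≟ᶠ e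
  ... | yes g^q≡e = q , 1 , q-prime , g≢e ∘ trans (sym (idʳ g)) , trans (cong (_^ q) (idʳ g)) g^q≡e
  ... | no g^q≢e with prime-order-power (g ^ q) qs qs-prime (trans (^-*-assoc g q _) g^[q*Q]≡e) g^q≢e
  ...   | p , k , p-prime , g^q^k≢e , g^q^k^p≡e =
    p , q * k , p-prime , g^q^k≢e ∘ trans (^-*-assoc g q k) ,
    trans (cong (_^ p) (sym (^-*-assoc g q k))) g^q^k^p≡e

  ∃-prime-order-power : ∀ g → g ≢ e → ∃₂ λ p k → Prime p × g ^ k ≢ e × (g ^ k) ^ p ≡ e
  ∃-prime-order-power g g≢e with finite-order g
  ... | N , g^[1+N]≡e with factorise (suc N)
  ... | record { factors = qs ; isFactorisation = 1+N≡∏qs ; factorsPrime = qs-prime } =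
    prime-order-power g qs qs-prime (trans (cong (g ^_) (sym 1+N≡∏qs)) g^[1+N]≡e) g≢e

-- Cauchy's theorem

length-cartesianProductWith : ∀ {A B C : Set} (f : A → B → C) xs ys →
                              length (cartesianProductWith f xs ys) ≡ length xs * length ys
length-cartesianProductWith f [] ys = refl
length-cartesianProductWith f (x ∷ xs) ys =
  trans (length-++ (map (f x) ys)) (cong₂ _+_ (length-map (f x) ys) (length-cartesianProductWith f xs ys))

∃-other-element : ∀ {A : Set} → DecidableEquality A → ∀ {a xs} → Unique xs → a ∈ xs → 1 < length xs →
                  ∃ λ b → b ∈ xs × b ≢ a
∃-other-element _≟_ {xs = _ ∷ []} _ _ (s≤s ())
∃-other-element _≟_ {a} {u ∷ v ∷ _} ((u≢v ∷ _) ∷ _) _ _ with u ≟ a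
... | yes refl = v , there (here refl) , u≢v ∘ sym
... | no u≢a = u , here refl , u≢a

module CauchyTheorem {n : ℕ} (G : FinGroup n) where
  open FinGroup G
  open Powers G using (_^_; ε^; inverseʳ-unique)

  prod : List (Fin n) → Fin n
  prod = foldr _·_ e

  prod-++ : ∀ u w → prod (u ++ w) ≡ prod u · prod w
  prod-++ [] w = sym (idˡ _)
  prod-++ (a ∷ u) w = trans (cong (a ·_) (prod-++ u w)) (sym (assoc _ _ _))

  prod-∷ʳ : ∀ w a → prod (w ∷ʳ a) ≡ prod w · a
  prod-∷ʳ w a = trans (prod-++ w (a ∷ [])) (cong (prod w ·_) (idʳ a))

  prod-replicate : ∀ k g → prod (replicate k g) ≡ g ^ k
  prod-replicate zero g = refl
  prod-replicate (suc k) g = cong (g ·_) (prod-replicate k g)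

  tuples : ℕ → List (List (Fin n))
  tuples zero = [] ∷ []
  tuples (suc k) = cartesianProductWith _∷_ (allFin n) (tuples k)

  length-tuples : ∀ k → length (tuples k) ≡ n ℕ.^ k
  length-tuples zero = refl
  length-tuples (suc k) =
    trans (length-cartesianProductWith _∷_ (allFin n) (tuples k))
          (cong₂ _*_ (length-tabulate {n = n} (λ i → i)) (length-tuples k))

  tuples-unique : ∀ k → Unique (tuples k)
  tuples-unique zero = [] ∷ []
  tuples-unique (suc k) = cartesianProductWith⁺ _∷_ ∷-injective (allFin⁺ n) (tuples-unique k)

  ∈-tuples⁺ : ∀ w → w ∈ tuples (length w)
  ∈-tuples⁺ [] = here refl
  ∈-tuples⁺ (a ∷ w) = ∈-cartesianProductWith⁺ _∷_ (∈-allFin a) (∈-tuples⁺ w)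

  ∈-tuples⁻ : ∀ k {w} → w ∈ tuples k → length w ≡ k
  ∈-tuples⁻ zero (here refl) = refl
  ∈-tuples⁻ (suc k) w∈ with ∈-cartesianProductWith⁻ _∷_ (allFin n) (tuples k) w∈
  ... | _ , _ , _ , v∈ , refl = cong suc (∈-tuples⁻ k v∈)

  rotate : List (Fin n) → List (Fin n)
  rotate [] = []
  rotate (a ∷ w) = w ∷ʳ a

  open Iteration rotate using (^-comm) renaming (_^_ to _^ᶠ_)

  rotate-^-++ : ∀ u w → (rotate ^ᶠ length u) (u ++ w) ≡ w ++ u
  rotate-^-++ [] w = sym (++-identityʳ w)
  rotate-^-++ (a ∷ u) w = begin
    (rotate ^ᶠ suc (length u)) (a ∷ u ++ w)   ≡⟨ ^-comm 1 (length u) (a ∷ u ++ w) ⟩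
    (rotate ^ᶠ length u) ((u ++ w) ∷ʳ a)      ≡⟨ cong (rotate ^ᶠ length u) (++-assoc u w (a ∷ [])) ⟩
    (rotate ^ᶠ length u) (u ++ w ∷ʳ a)        ≡⟨ rotate-^-++ u (w ∷ʳ a) ⟩
    w ∷ʳ a ++ u                               ≡⟨ ++-assoc w (a ∷ []) u ⟩
    w ++ a ∷ u                                ∎
    where open ≡-Reasoning

  rotate-fixed⇒replicate : ∀ g r → rotate (g ∷ r) ≡ g ∷ r → r ≡ replicate (length r) g
  rotate-fixed⇒replicate g [] _ = refl
  rotate-fixed⇒replicate g (h ∷ r) rotate-fixed with ∷-injective rotate-fixed
  ... | refl , r∷ʳg≡g∷r = cong (g ∷_) (rotate-fixed⇒replicate g r r∷ʳg≡g∷r)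

  replicate-∷ʳ : ∀ k (g : Fin n) → replicate k g ∷ʳ g ≡ g ∷ replicate k g
  replicate-∷ʳ zero g = refl
  replicate-∷ʳ (suc k) g = cong (g ∷_) (replicate-∷ʳ k g)

  -- ε-tuples k consists of the (k+1)-tuples with product e: every k-tuple completed by its inverse.
  ε-tuples : ℕ → List (List (Fin n))
  ε-tuples k = map (λ w → w ∷ʳ inv (prod w)) (tuples k)

  length-ε-tuples : ∀ k → length (ε-tuples k) ≡ n ℕ.^ k
  length-ε-tuples k = trans (length-map _ (tuples k)) (length-tuples k)

  ε-tuples-unique : ∀ k → Unique (ε-tuples k)
  ε-tuples-unique k = map⁺ (∷ʳ-injectiveˡ _ _) (tuples-unique k)

  ∈-ε-tuples⁻ : ∀ k {w} → w ∈ ε-tuples k → length w ≡ suc k × prod w ≡ e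
  ∈-ε-tuples⁻ k w∈ with ∈-map⁻ _ w∈
  ... | v , v∈ , refl =
    trans (length-++ v) (trans (+-comm (length v) 1) (cong suc (∈-tuples⁻ k v∈))) ,
    trans (prod-∷ʳ v _) (invʳ (prod v))

  ∈-ε-tuples⁺ : ∀ k {w} → length w ≡ suc k → prod w ≡ e → w ∈ ε-tuples k
  ∈-ε-tuples⁺ k {w} |w|≡1+k prod≡e with initLast w
  ∈-ε-tuples⁺ k {.(v ∷ʳ a)} |w|≡1+k prod≡e | v ∷ʳ′ a =
    subst (_∈ ε-tuples k) (cong (v ∷ʳ_) (sym a≡prod⁻¹))
      (∈-map⁺ _ (subst (λ m → v ∈ tuples m) |v|≡k (∈-tuples⁺ v)))
    where
    a≡prod⁻¹ : a ≡ inv (prod v)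
    a≡prod⁻¹ = inverseʳ-unique (prod v) a (trans (sym (prod-∷ʳ v a)) prod≡e)
    |v|≡k : length v ≡ k
    |v|≡k = suc-injective (trans (trans (+-comm 1 (length v)) (sym (length-++ v))) |w|≡1+k)

  ε-tuples-closed : ∀ k {w} → w ∈ ε-tuples k → rotate w ∈ ε-tuples k
  ε-tuples-closed k {w} w∈ with ∈-ε-tuples⁻ k w∈
  ε-tuples-closed k {a ∷ v} w∈ | |w|≡1+k , a·prod≡e =
    ∈-ε-tuples⁺ k (trans (length-++ v) (trans (+-comm (length v) 1) |w|≡1+k))
      (trans (prod-∷ʳ v a) (trans (cong (_· a) (inverseʳ-unique a (prod v) a·prod≡e)) (invˡ a)))

  ε-tuples-periodic : ∀ k {w} → w ∈ ε-tuples k → (rotate ^ᶠ suc k) w ≡ w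
  ε-tuples-periodic k {w} w∈ = begin
    (rotate ^ᶠ suc k) w              ≡⟨ cong (λ m → (rotate ^ᶠ m) w) (sym (proj₁ (∈-ε-tuples⁻ k w∈))) ⟩
    (rotate ^ᶠ length w) w           ≡⟨ cong (rotate ^ᶠ length w) (sym (++-identityʳ w)) ⟩
    (rotate ^ᶠ length w) (w ++ [])   ≡⟨ rotate-^-++ w [] ⟩
    w                                ∎
    where open ≡-Reasoning

  module _ {k} (q-prime : Prime (2 + k)) (q∣n : 2 + k ∣ n) where
    open OrbitCounting (≡-dec _≟ᶠ_) rotate q-prime using (Fixed?; fixed-points-divisible)

    fixed-ε-tuples : List (List (Fin n))
    fixed-ε-tuples = filter Fixed? (ε-tuples (suc k))

    1∈fixed : replicate (2 + k) e ∈ fixed-ε-tuples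
    1∈fixed = ∈-filter⁺ Fixed?
      (∈-ε-tuples⁺ (suc k) (length-replicate (2 + k)) (trans (prod-replicate (2 + k) e) (ε^ (2 + k))))
      (replicate-∷ʳ (suc k) e)

    q∣|fixed| : 2 + k ∣ length fixed-ε-tuples
    q∣|fixed| =
      fixed-points-divisible (ε-tuples-unique (suc k)) (ε-tuples-closed (suc k)) (ε-tuples-periodic (suc k))
                  (subst (2 + k ∣_) (sym (length-ε-tuples (suc k))) (∣-trans q∣n (m∣m*n (n ℕ.^ k))))

    1<|fixed| : 1 < length fixed-ε-tuples
    1<|fixed| = ≤-trans (prime⇒1< q-prime) (∣⇒≤ {{ℕ.>-nonZero (∈-length 1∈fixed)}} q∣|fixed|)

    -- Rotation-fixed tuples are constant and q divides their number, so besides e…e some g…g is fixed.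
    element-of-order : ∃ λ g → g ≢ e × g ^ (2 + k) ≡ e
    element-of-order
      with ∃-other-element (≡-dec _≟ᶠ_) (filter⁺ Fixed? (ε-tuples-unique (suc k))) 1∈fixed 1<|fixed|
    ... | [] , []∈fixed , _ with ∈-ε-tuples⁻ (suc k) (proj₁ (∈-filter⁻ Fixed? []∈fixed))
    ...   | () , _
    element-of-order | g ∷ r , u∈fixed , u≢1 with ∈-filter⁻ Fixed? u∈fixed
    ...   | u∈ε-tuples , u-fixed with ∈-ε-tuples⁻ (suc k) u∈ε-tuples
    ...     | |u|≡q , prod-u≡e = g , g≢e , g^q≡e
      where
      u≡g^q : g ∷ r ≡ replicate (2 + k) g
      u≡g^q = cong (g ∷_) (trans (rotate-fixed⇒replicate g r u-fixed)
                                 (cong (λ m → replicate m g) (suc-injective |u|≡q)))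
      g≢e : g ≢ e
      g≢e refl = u≢1 u≡g^q
      g^q≡e : g ^ (2 + k) ≡ e
      g^q≡e = trans (sym (prod-replicate (2 + k) g)) (trans (cong prod (sym u≡g^q)) prod-u≡e)

  cauchy : ∀ {q} → Prime q → q ∣ n → ∃ λ g → g ≢ e × g ^ q ≡ e
  cauchy q-prime q∣n with prime⇒1< q-prime
  ... | s≤s (s≤s _) = element-of-order q-prime q∣n

-- Distances to a central element of prime order

module Hub {n : ℕ} (G : FinGroup n) where
  open FinGroup G
  open Powers G
  open Subgroups G
  open CoprimeOrders G
  open CyclicSubgroups G

  module _ {p : ℕ} (p-prime : Prime p) {z : Fin n}
           (z-central : ∀ g → z · g ≡ g · z) (z≢e : z ≢ e) (z^p≡e : z ^ p ≡ e) where

    Near : ℕ → Fin n → Set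
    Near d x = ∃ λ k → k ≤ d × DWalk G x z k

    DAdj-hub : ∀ {g r} → p ∤ r → g ^ r ≡ e → g ≢ e → DAdj G g z
    DAdj-hub p∤r g^r≡e g≢e =
      DAdj-coprime-orders (sym (z-central _)) (coprime-sym (∤⇒coprime p-prime p∤r)) g^r≡e z^p≡e g≢e z≢e

    module _ {c a r} (p∤r : p ∤ r) (c^[P*r]≡e : c ^ (p ℕ.^ a * r) ≡ e) (i j : ℕ)
             (x∉⟨y⟩ : ¬ InCyc G (c ^ i) (c ^ j)) (y∉⟨x⟩ : ¬ InCyc G (c ^ j) (c ^ i)) where
      private
        P = p ℕ.^ a
        x = c ^ i

      x≢e : x ≢ e
      x≢e x≡e = x∉⟨y⟩ (gen-ε x≡e)

      P⊥r : Coprime P r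
      P⊥r = ∤⇒coprime-^ p-prime p∤r a

      c^P^r≡e : (c ^ P) ^ r ≡ e
      c^P^r≡e = trans (^-*-assoc c P r) c^[P*r]≡e

      c^r^P≡e : (c ^ r) ^ P ≡ e
      c^r^P≡e = trans (^-comm c r P) c^P^r≡e

      x^P^r≡e : (x ^ P) ^ r ≡ e
      x^P^r≡e = trans (^-*-assoc x P r) (^-annihilates-powers c (P * r) i c^[P*r]≡e)

      c^P≢e : c ^ P ≢ e
      c^P≢e c^P≡e with cyclic-p-group-chain p-prime a i j c^P≡e
      ... | inj₁ x∈⟨y⟩ = x∉⟨y⟩ x∈⟨y⟩
      ... | inj₂ y∈⟨x⟩ = y∉⟨x⟩ y∈⟨x⟩

      via-c^P : DAdj G x (c ^ P) → Near 3 x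
      via-c^P x~c^P = 2 , s≤s (s≤s z≤n) , walk-cons x~c^P (walk-cons (DAdj-hub p∤r c^P^r≡e c^P≢e) walk-nil)

      -- x ~ z if x^r = e; otherwise x ~ c^P ~ z if c^r ∈ ⟨x⟩ or x^P = e, and x ~ c^r ~ x^P ~ z if not.
      power-near-hub : Near 3 x
      power-near-hub with x ^ r ≟ᶠ e
      ... | yes x^r≡e = 1 , s≤s z≤n , walk-cons (DAdj-hub p∤r x^r≡e x≢e) walk-nil
      ... | no x^r≢e with cyc? (c ^ r) x
      ...   | yes c^r∈⟨x⟩ = via-c^P (DAdj-coprime-part i P⊥r c^[P*r]≡e x^r≢e c^P∉⟨x⟩)
        where
        c^P∉⟨x⟩ : ¬ InCyc G (c ^ P) x
        c^P∉⟨x⟩ c^P∈⟨x⟩ = y∉⟨x⟩ (cyc-trans (cyc-^ c j) (gen-coprime (coprime-sym P⊥r) c^r∈⟨x⟩ c^P∈⟨x⟩))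
      ...   | no c^r∉⟨x⟩ with x ^ P ≟ᶠ e
      ...     | yes x^P≡e =
                via-c^P (DAdj-coprime-orders (cyc-commute (cyc-^ c i) (cyc-^ c P))
                                             P⊥r x^P≡e c^P^r≡e x≢e c^P≢e)
      ...     | no x^P≢e = 3 , ≤-refl , walk-cons x~c^r (walk-cons c^r~x^P (walk-cons x^P~z walk-nil))
        where
        x~c^r : DAdj G x (c ^ r)
        x~c^r = DAdj-coprime-part i (coprime-sym P⊥r) (trans (cong (c ^_) (*-comm r P)) c^[P*r]≡e)
                  x^P≢e c^r∉⟨x⟩
        c^r~x^P : DAdj G (c ^ r) (x ^ P)
        c^r~x^P = DAdj-coprime-orders (cyc-commute (cyc-^ c r) (cyc-trans (cyc-^ x P) (cyc-^ c i)))
                    P⊥r c^r^P≡e x^P^r≡e (c^r∉⟨x⟩ ∘ gen-ε) x^P≢e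
        x^P~z : DAdj G (x ^ P) z
        x^P~z = DAdj-hub p∤r x^P^r≡e x^P≢e

    vertex-near-hub : ∀ {x} → DVertex G x → Near 3 x
    vertex-near-hub {x} (y , _ , (c , ⟨x,y⟩≡⟨c⟩) , x∉⟨y⟩ , y∉⟨x⟩)
      with cyc⇒power (Equivalence.to (⟨x,y⟩≡⟨c⟩ x) (gen-∈ (here refl)))
         | cyc⇒power (Equivalence.to (⟨x,y⟩≡⟨c⟩ y) (gen-∈ (there (here refl))))
         | finite-order c
    ... | i , refl | j , refl | N , c^[1+N]≡e with p-part p-prime (suc N) (λ ())
    ...   | a , r , 1+N≡P*r , p∤r =
            power-near-hub {a = a} p∤r (trans (cong (c ^_) (sym 1+N≡P*r)) c^[1+N]≡e) i j x∉⟨y⟩ y∉⟨x⟩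

module Walks {n : ℕ} (G : FinGroup n) where
  open CoprimeOrders G using (DAdj-sym)

  walk-snoc : ∀ {x y w k} → DWalk G x y k → DAdj G y w → DWalk G x w (suc k)
  walk-snoc walk-nil y~w = walk-cons y~w walk-nil
  walk-snoc (walk-cons x~x′ x′⇝y) y~w = walk-cons x~x′ (walk-snoc x′⇝y y~w)

  walk-reverse : ∀ {x y k} → DWalk G x y k → DWalk G y x k
  walk-reverse walk-nil = walk-nil
  walk-reverse (walk-cons x~x′ x′⇝y) = walk-snoc (walk-reverse x′⇝y) (DAdj-sym x~x′)

  walk-++ : ∀ {x y w k l} → DWalk G x y k → DWalk G y w l → DWalk G x w (k + l)
  walk-++ walk-nil y⇝w = y⇝w
  walk-++ (walk-cons x~x′ x′⇝y) y⇝w = walk-cons x~x′ (walk-++ x′⇝y y⇝w)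

theorem3p1 : ∀ {n : ℕ} (G : FinGroup n) → ¬ IsPGroupOrder n →
    CenterNontrivial G → ConnectedDiamLe G 6
theorem3p1 {n} G ¬p-group (z₀ , z₀≢e , z₀-central) with CyclicSubgroups.∃-prime-order-power G z₀ z₀≢e
... | p , k , p-prime , z≢e , z^p≡e = vertex , connected
  where
  open FinGroup G
  open Powers G using (_^_; comm-^)
  open Hub G using (DAdj-hub; vertex-near-hub)
  open Walks G
  open CauchyTheorem G using (cauchy)
  instance _ = nonZeroIndex e

  z-central : ∀ g → z₀ ^ k · g ≡ g · z₀ ^ k
  z-central g = sym (comm-^ (sym (z₀-central g)) k)

  vertex : ∃ λ v → DVertex G v
  vertex with ¬prime-power⇒other-prime-divisor ¬p-group p-prime
  ... | q , q-prime , q∣n , q≢p with cauchy q-prime q∣n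
  ... | g , g≢e , g^q≡e =
    g , z₀ ^ k ,
    DAdj-hub p-prime z-central z≢e z^p≡e (distinct-primes-∤ p-prime q-prime (q≢p ∘ sym)) g^q≡e g≢e

  connected : ∀ u v → DVertex G u → DVertex G v → ∃ λ d → d ≤ 6 × DWalk G u v d
  connected u v u∈D v∈D with vertex-near-hub p-prime z-central z≢e z^p≡e u∈D
                           | vertex-near-hub p-prime z-central z≢e z^p≡e v∈D
  ... | a , a≤3 , u⇝z | b , b≤3 , v⇝z = a + b , +-mono-≤ a≤3 b≤3 , walk-++ u⇝z (walk-reverse v⇝z)
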